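{- For every integer $m\ge 1$, the cycle chain $\mathcal{C}_4^m$ has a prime vertex labeling.
   Context: All graphs are simple and connected. A graph with $N$ vertices has a prime vertex labeling if its vertices can be labeled bijectively with $1,2,\ldots,N$ so that adjacent vertices receive relatively prime labels. For even $n\ge 4$ and $m\ge 1$, the cycle chain $\mathcal{C}_n^m$ consists of $m$ copies $C^{(1)},\ldots,C^{(m)}$ of the $n$-cycle such that consecutive cycles $C^{(i)}$ and $C^{(i+1)}$ share exactly one common vertex, non-consecutive cycles share no vertex, and in each cycle $C^{(i)}$ with $1<i<m$ the two shared vertices (the one shared with $C^{(i-1)}$ and the one shared with $C^{(i+1)}$) are at distance $n/2$ in that cycle, i.e. they split it into two paths of equal length $n/2$. It has $m(n-1)+1$ vertices. -}

module Defs where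

open import Data.Nat using (ℕ; suc; _+_; _*_; _<_)
open import Data.Nat.Coprimality using (Coprime)
open import Data.Fin using (Fin; toℕ)
open import Data.Sum using (_⊎_)
open import Data.Product using (Σ; _×_)
open import Function.Definitions using (Bijective)
open import Relation.Binary.PropositionalEquality using (_≡_)

-- A prime vertex labeling: a bijection f : Fin N → Fin N, where vertex v
-- receives label (toℕ (f v) + 1) ∈ {1,…,N}, such that adjacent vertices
-- receive coprime labels.
HasPrimeLabeling : (N : ℕ) → (Fin N → Fin N → Set) → Set
HasPrimeLabeling N Adj =
  Σ (Fin N → Fin N) λ f →
    Bijective _≡_ _≡_ f ×
    (∀ u v → Adj u v → Coprime (suc (toℕ (f u))) (suc (toℕ (f v))))

-- Cycle i (0 ≤ i < m) has vertices b, b+1, b+2, b+3 with b = 3i and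
-- cyclic order  b – b+1 – b+3 – b+2 – b.
-- Consecutive cycles i, i+1 share exactly the vertex 3(i+1); in cycle i the
-- shared vertices b and b+3 are at distance 2 = n/2, as required.
data C4ChainEdge (m : ℕ) : ℕ → ℕ → Set where
  e₀₁ : ∀ i → i < m → C4ChainEdge m (3 * i) (3 * i + 1)
  e₁₃ : ∀ i → i < m → C4ChainEdge m (3 * i + 1) (3 * i + 3)
  e₃₂ : ∀ i → i < m → C4ChainEdge m (3 * i + 3) (3 * i + 2)
  e₂₀ : ∀ i → i < m → C4ChainEdge m (3 * i + 2) (3 * i)

C4ChainAdj : (m : ℕ) → Fin (m * 3 + 1) → Fin (m * 3 + 1) → Set
C4ChainAdj m u v = C4ChainEdge m (toℕ u) (toℕ v) ⊎ C4ChainEdge m (toℕ v) (toℕ u)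

-- Vertex v of the chain (0 ≤ v ≤ 3m) receives the label 1 + chainLabel m v,
-- where chainLabel m is the involution of ℕ obtained from the identity by
-- swapping, for every pair of consecutive cycles starting at vertex 6j, the
-- vertices 6j+3 and 6j+4, and, when m is odd, the last two vertices 3m-1, 3m.
-- The labels of a cycle pair starting at 6j are therefore
--   6j + (1, 2, 3, 5)  and  6j + (5, 4, 6, 7)
-- along the vertices b, b+1, b+2, b+3 of its two cycles, and 6j + (1, 2, 4, 3)
-- on a lone last cycle.  Adjacent labels differ by 1, 2 or 3, and which
-- pairs are coprime depends only on the offsets modulo 6.
module Submission where

open import Defs
open import Data.Nat using (ℕ; _≤_; _*_; _+_; zero; suc; _<_; s≤s)
open import Data.Nat.Properties using (+-assoc; ≰⇒>; <⇒≱)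
open import Data.Nat.Divisibility using (_∣_; _∣?_; ∣m+n∣m⇒∣n; ∣-trans; ∣m⇒∣m*n)
open import Data.Nat.Coprimality using (Coprime; coprime?; coprime-+)
import Data.Nat.Coprimality as Coprime
open import Data.Nat.Tactic.RingSolver using (solve-∀)
open import Data.Fin using (Fin; toℕ; fromℕ<)
open import Data.Fin.Properties using (toℕ-fromℕ<; toℕ-injective; toℕ<n)
open import Data.Sum using (inj₁; inj₂)
open import Data.Product using (_×_; _,_; ∃)
open import Function.Definitions using (Bijective)
open import Relation.Nullary.Decidable using (True; toWitness)
open import Relation.Binary.PropositionalEquality

involution-bounded : ∀ {n} (g : ℕ → ℕ) → (∀ v → g (g v) ≡ v) →
                     (∀ v → n ≤ v → g v ≡ v) → ∀ v → v < n → g v < n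
involution-bounded g involutive fixed v v<n = ≰⇒> λ n≤gv →
  <⇒≱ v<n (subst (_ ≤_) (trans (sym (fixed (g v) n≤gv)) (involutive v)) n≤gv)

module _ {n : ℕ} (g : ℕ → ℕ) (bounded : ∀ v → v < n → g v < n) where

  restrict : Fin n → Fin n
  restrict u = fromℕ< (bounded (toℕ u) (toℕ<n u))

  toℕ-restrict : ∀ u → toℕ (restrict u) ≡ g (toℕ u)
  toℕ-restrict u = toℕ-fromℕ< (bounded (toℕ u) (toℕ<n u))

  -- An involution restricts to an involution, hence to a bijection.
  restrict-bijective : (∀ v → g (g v) ≡ v) → Bijective _≡_ _≡_ restrict
  restrict-bijective involutive = injective , surjective
    where
    restrict-involutive : ∀ u → restrict (restrict u) ≡ u
    restrict-involutive u = toℕ-injective (begin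
      toℕ (restrict (restrict u)) ≡⟨ toℕ-restrict (restrict u) ⟩
      g (toℕ (restrict u))        ≡⟨ cong g (toℕ-restrict u) ⟩
      g (g (toℕ u))               ≡⟨ involutive (toℕ u) ⟩
      toℕ u                       ∎)
      where open ≡-Reasoning

    injective : ∀ {u w} → restrict u ≡ restrict w → u ≡ w
    injective {u} {w} eq =
      trans (sym (restrict-involutive u)) (trans (cong restrict eq) (restrict-involutive w))

    surjective : ∀ w → ∃ λ u → ∀ {z} → z ≡ u → restrict z ≡ w
    surjective w = restrict w , λ { refl → restrict-involutive w }

-- chainLabel m v + 1 is the label of vertex v in C₄ᵐ.  Two cycles (six new
-- vertices) are handled per recursive step; a lone last cycle swaps 2 and 3.
chainLabel : ℕ → ℕ → ℕ
chainLabel zero v = v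
chainLabel (suc zero) 2 = 3
chainLabel (suc zero) 3 = 2
chainLabel (suc zero) v = v
chainLabel (suc (suc m)) 3 = 4
chainLabel (suc (suc m)) 4 = 3
chainLabel (suc (suc m)) (suc (suc (suc (suc (suc (suc v)))))) = 6 + chainLabel m v
chainLabel (suc (suc m)) v = v

-- Each recursive step only swaps within {3, 4} or {2, 3}, so it undoes itself.
chainLabel-involutive : ∀ m v → chainLabel m (chainLabel m v) ≡ v
chainLabel-involutive zero v = refl
chainLabel-involutive (suc zero) 0 = refl
chainLabel-involutive (suc zero) 1 = refl
chainLabel-involutive (suc zero) 2 = refl
chainLabel-involutive (suc zero) 3 = refl
chainLabel-involutive (suc zero) (suc (suc (suc (suc v)))) = refl
chainLabel-involutive (suc (suc m)) 0 = refl
chainLabel-involutive (suc (suc m)) 1 = refl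
chainLabel-involutive (suc (suc m)) 2 = refl
chainLabel-involutive (suc (suc m)) 3 = refl
chainLabel-involutive (suc (suc m)) 4 = refl
chainLabel-involutive (suc (suc m)) 5 = refl
chainLabel-involutive (suc (suc m)) (suc (suc (suc (suc (suc (suc v)))))) =
  cong (6 +_) (chainLabel-involutive m v)

chainLabel-fixed : ∀ m v → m * 3 + 1 ≤ v → chainLabel m v ≡ v
chainLabel-fixed zero v _ = refl
chainLabel-fixed (suc zero) _ (s≤s (s≤s (s≤s (s≤s _)))) = refl
chainLabel-fixed (suc (suc m)) _ (s≤s (s≤s (s≤s (s≤s (s≤s (s≤s {n = v} le)))))) =
  cong (6 +_) (chainLabel-fixed m v le)

-- The first vertex keeps label 1; needed where a cycle pair meets the next.
chainLabel-zero : ∀ m → chainLabel m 0 ≡ 0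
chainLabel-zero zero = refl
chainLabel-zero (suc zero) = refl
chainLabel-zero (suc (suc m)) = refl

chainLabel-bounded : ∀ m v → v < m * 3 + 1 → chainLabel m v < m * 3 + 1
chainLabel-bounded m =
  involution-bounded (chainLabel m) (chainLabel-involutive m) (chainLabel-fixed m)

Compatible : ℕ → ℕ → Set
Compatible x y = ∀ j → Coprime (6 * j + suc x) (6 * j + suc y)

compatible-sym : ∀ {x y} → Compatible x y → Compatible y x
compatible-sym c j = Coprime.sym (c j)

next-block : ∀ j z → 6 * suc j + suc z ≡ 6 * j + suc (6 + z)
next-block = solve-∀

compatible-shift : ∀ {x y} → Compatible x y → Compatible (6 + x) (6 + y)
compatible-shift {x} {y} c j = subst₂ Coprime (next-block j x) (next-block j y) (c (suc j))

-- If k ∣ n then a common divisor of n + r and k divides r.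
coprime-offset : ∀ {n r k} → k ∣ n → Coprime r k → Coprime (n + r) k
coprime-offset k∣n r⊥k (d∣n+r , d∣k) = r⊥k (∣m+n∣m⇒∣n d∣n+r (∣-trans d∣k k∣n) , d∣k)

-- Labels at distance k ∣ 6 are compatible as soon as the first is coprime
-- to k; both side conditions are closed and are decided by computation.
compatible : ∀ x k → {True (coprime? (suc x) k)} → {True (k ∣? 6)} → Compatible x (x + k)
compatible x k {x⊥k} {k∣6} j =
  subst (Coprime a) (+-assoc (6 * j) (suc x) k)
    (Coprime.sym (coprime-+ (Coprime.sym a⊥k)))
  where
  a : ℕ
  a = 6 * j + suc x
  a⊥k : Coprime a k
  a⊥k = coprime-offset (∣m⇒∣m*n j (toWitness k∣6)) (toWitness x⊥k)

-- A cycle whose vertices w, w+1, w+2, w+3 carry offsets a, b, c, d has its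
-- four edges w–w+1–w+3–w+2–w joining compatible labels.
GoodCycle : ℕ → ℕ → ℕ → ℕ → Set
GoodCycle a b c d = Compatible a b × Compatible b d × Compatible d c × Compatible c a

goodCycle-shift : ∀ {a b c d} → GoodCycle a b c d → GoodCycle (6 + a) (6 + b) (6 + c) (6 + d)
goodCycle-shift (ab , bd , dc , ca) =
  compatible-shift ab , compatible-shift bd , compatible-shift dc , compatible-shift ca

first-of-pair : GoodCycle 0 1 2 4
first-of-pair = compatible 0 1 , compatible 1 3 , compatible-sym (compatible 2 2)
              , compatible-sym (compatible 0 2)

second-of-pair : GoodCycle 4 3 5 6
second-of-pair = compatible-sym (compatible 3 1) , compatible 3 3
               , compatible-sym (compatible 5 1) , compatible-sym (compatible 4 1)

lone-cycle : GoodCycle 0 1 3 2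
lone-cycle = compatible 0 1 , compatible 1 1 , compatible 2 1 , compatible-sym (compatible 0 3)

three-times-suc-suc : ∀ i → 3 * suc (suc i) ≡ 6 + 3 * i
three-times-suc-suc = solve-∀

GoodCycleAt : ℕ → ℕ → Set
GoodCycleAt m b = GoodCycle (chainLabel m b) (chainLabel m (b + 1))
                            (chainLabel m (b + 2)) (chainLabel m (b + 3))

-- Every cycle of C₄ᵐ is good; cycles beyond the first pair reduce to those
-- of C₄ᵐ⁻² shifted by six vertices.
cycle-good : ∀ m i → i < m → GoodCycleAt m (3 * i)
cycle-good (suc zero) zero _ = lone-cycle
cycle-good (suc zero) (suc i) (s≤s ())
cycle-good (suc (suc m)) zero _ = first-of-pair
cycle-good (suc (suc m)) 1 _ rewrite chainLabel-zero m = second-of-pair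
cycle-good (suc (suc m)) (suc (suc i)) (s≤s (s≤s i<m)) =
  subst (GoodCycleAt (suc (suc m))) (sym (three-times-suc-suc i))
    (goodCycle-shift (cycle-good m i i<m))

edge-compatible : ∀ {m u v} → C4ChainEdge m u v → Compatible (chainLabel m u) (chainLabel m v)
edge-compatible {m} (e₀₁ i i<m) = let (ab , _ , _ , _) = cycle-good m i i<m in ab
edge-compatible {m} (e₁₃ i i<m) = let (_ , bd , _ , _) = cycle-good m i i<m in bd
edge-compatible {m} (e₃₂ i i<m) = let (_ , _ , dc , _) = cycle-good m i i<m in dc
edge-compatible {m} (e₂₀ i i<m) = let (_ , _ , _ , ca) = cycle-good m i i<m in ca

theorem2 : (m : ℕ) → 1 ≤ m → HasPrimeLabeling (m * 3 + 1) (C4ChainAdj m)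
theorem2 m _ = f , restrict-bijective g bounded (chainLabel-involutive m) , adjacent-coprime
  where
  g : ℕ → ℕ
  g = chainLabel m
  bounded : ∀ v → v < m * 3 + 1 → g v < m * 3 + 1
  bounded = chainLabel-bounded m
  f : Fin (m * 3 + 1) → Fin (m * 3 + 1)
  f = restrict g bounded

  -- Block j = 0 of a compatible pair is the pair of actual labels.
  edge-coprime : ∀ u v → C4ChainEdge m (toℕ u) (toℕ v) → Coprime (suc (toℕ (f u))) (suc (toℕ (f v)))
  edge-coprime u v e = subst₂ (λ x y → Coprime (suc x) (suc y))
    (sym (toℕ-restrict g bounded u)) (sym (toℕ-restrict g bounded v)) (edge-compatible e 0)

  adjacent-coprime : ∀ u v → C4ChainAdj m u v → Coprime (suc (toℕ (f u))) (suc (toℕ (f v)))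
  adjacent-coprime u v (inj₁ e) = edge-coprime u v e
  adjacent-coprime u v (inj₂ e) = Coprime.sym (edge-coprime v u e)
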